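{- For every odd integer $n\geq5$, $H_{A}(C_{n})<H_{A}(CS_{3,n-3})$.
   Context: For a graph $G$, $\delta_G(v)$ is the degree of $v$ and $d_G(u,v)$ the distance between $u$ and $v$. The additively weighted Harary index is $H_A(G)=\sum_{\{u,v\}}\frac{\delta_G(u)+\delta_G(v)}{d_G(u,v)}$, over unordered pairs of distinct vertices. $C_n$ is the cycle on $n$ vertices. $CS_{3,n-3}$ is the graph on $n$ vertices consisting of a triangle together with $n-3$ leaves all adjacent to the same vertex of the triangle. -}

module Defs where

open import Data.Nat using (ℕ; zero; suc; _+_; _≡ᵇ_)
open import Data.Bool using (Bool; true; false; _∧_; _∨_; not; if_then_else_)
open import Data.Fin using (Fin; toℕ)
open import Data.List using (List; []; _∷_; allFin; foldr; map; filter)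
open import Data.Maybe using (Maybe; just; nothing)
open import Data.Integer using (+_)
open import Data.Rational using (ℚ; 0ℚ; _/_) renaming (_+_ to _+ℚ_)

Graph : ℕ → Set
Graph n = Fin n → Fin n → Bool

anyFin : ∀ {n} → (Fin n → Bool) → Bool
anyFin {n} p = foldr (λ x b → p x ∨ b) false (allFin n)

countFin : ∀ {n} → (Fin n → Bool) → ℕ
countFin {n} p = foldr (λ x c → if p x then suc c else c) 0 (allFin n)

degree : ∀ {n} → Graph n → Fin n → ℕ
degree G v = countFin (λ w → G v w)

_==_ : ∀ {n} → Fin n → Fin n → Bool
i == j = toℕ i ≡ᵇ toℕ j

reach : ∀ {n} → Graph n → ℕ → Fin n → Fin n → Bool
reach G zero u v = u == v
reach G (suc k) u v = reach G k u v ∨ anyFin (λ w → reach G k u w ∧ G w v)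

searchDist : ∀ {n} → Graph n → ℕ → ℕ → Fin n → Fin n → Maybe ℕ
searchDist G start zero u v = if reach G start u v then just start else nothing
searchDist G start (suc fuel) u v =
  if reach G start u v then just start else searchDist G (suc start) fuel u v

-- graph distance d_G(u,v): length of a shortest u–v path (nothing if disconnected).
-- A shortest path in a graph on n vertices has length < n, so searching 0..n suffices.
dist : ∀ {n} → Graph n → Fin n → Fin n → Maybe ℕ
dist {n} G u v = searchDist G 0 n u v

sumℚ : List ℚ → ℚ
sumℚ = foldr _+ℚ_ 0ℚ

-- contribution (δ(u)+δ(v))/d(u,v) of a pair; pairs at infinite distance contribute 0
-- (irrelevant here: all graphs considered are connected)
pairTerm : ∀ {n} → Graph n → Fin n → Fin n → ℚ
pairTerm G u v with dist G u v
... | just (suc d) = (+ (degree G u + degree G v)) / suc d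
... | just zero = 0ℚ
... | nothing = 0ℚ

-- additively weighted Harary index: sum over unordered pairs {u,v}, u ≠ v,
-- enumerated as toℕ u < toℕ v
HA : ∀ {n} → Graph n → ℚ
HA {n} G = sumℚ (map (λ u → sumℚ (map (λ v → if suc (toℕ u) Data.Nat.≤ᵇ toℕ v then pairTerm G u v else 0ℚ) (allFin n))) (allFin n))

-- the cycle C_n on vertices 0,…,n-1 : i ~ i+1 and n-1 ~ 0 (meant for n ≥ 3)
cycleGraph : (n : ℕ) → Graph n
cycleGraph n i j =
  (suc (toℕ i) ≡ᵇ toℕ j) ∨ (suc (toℕ j) ≡ᵇ toℕ i)
  ∨ ((toℕ i ≡ᵇ 0) ∧ (suc (toℕ j) ≡ᵇ n))
  ∨ ((toℕ j ≡ᵇ 0) ∧ (suc (toℕ i) ≡ᵇ n))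

-- CS_{3,n-3}: triangle on 0,1,2 and leaves 3,…,n-1 all adjacent to vertex 0
csGraph : (n : ℕ) → Graph n
csGraph n i j =
  ((toℕ i ≡ᵇ 0) ∧ not (toℕ j ≡ᵇ 0))
  ∨ ((toℕ j ≡ᵇ 0) ∧ not (toℕ i ≡ᵇ 0))
  ∨ ((toℕ i ≡ᵇ 1) ∧ (toℕ j ≡ᵇ 2))
  ∨ ((toℕ i ≡ᵇ 2) ∧ (toℕ j ≡ᵇ 1))

-- Every vertex of C_n has degree 2, so a pair of vertices contributes at most 2 + 2 = 4 to
-- H_A if it is an edge and at most 4 / 2 = 2 otherwise; hence H_A(C_n) ≤ n(n-1) + 4n.  In
-- CS_{3,n-3} each pair containing the centre (of degree n-1) is an edge and contributes at
-- least n, and each other pair lies at distance at most 2 (through the centre) with both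
-- degrees positive, so contributes at least 1; hence H_A(CS_{3,n-3}) ≥ n(n-1) + (n-1)(n-2)/2.
-- The second bound exceeds the first once n ≥ 11, and n = 5, 7, 9 are settled by evaluation.
module Submission where

open import Data.Bool using (Bool; true; false; T; _∧_; _∨_; if_then_else_)
import Data.Bool.Properties as Bool
open import Data.Empty using (⊥-elim)
open import Data.Fin using (Fin; zero; suc; toℕ)
import Data.Fin.Properties as Fin
open import Data.Integer using (+_)
import Data.Integer as ℤ
import Data.Integer.Properties as ℤ
open import Data.List using (foldr; map; tabulate; allFin)
open import Data.Maybe using (just; nothing)
open import Data.Nat as ℕ
  using (ℕ; zero; suc; _+_; _*_; _∸_; _≤_; _≤ᵇ_; _≡ᵇ_; z≤n; s≤s; _≤′_; ≤′-refl; ≤′-step)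
import Data.Nat.Properties as ℕ
open import Algebra.Properties.Semiring.Sum ℕ.+-*-semiring
  using (sum; sum-syntax; sum-cong-≗; ∑-distrib-+; *-distribˡ-sum)
open import Data.Nat.Tactic.RingSolver using (solve-∀)
open import Data.Product using (∃; _×_; _,_; proj₁; proj₂)
open import Data.Rational as ℚ using (ℚ; 0ℚ; _/_; _<_)
import Data.Rational.Properties as ℚ
open import Data.Rational.Unnormalised as ℚᵘ using (mkℚᵘ; *≤*; *<*; *≡*)
import Data.Rational.Unnormalised.Properties as ℚᵘ
open import Data.Sum using (inj₁; inj₂)
open import Defs
open import Function using (_∘_; Equivalence)
open import Relation.Binary.PropositionalEquality
  using (_≡_; _≢_; refl; sym; trans; cong; cong₂; subst; subst₂; module ≡-Reasoning)
open import Relation.Nullary.Decidable using (toWitness)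

fromℕ : ℕ → ℚ
fromℕ a = + a / 1

toℚᵘ-/ : ∀ a d → ℚ.toℚᵘ (+ a / suc d) ℚᵘ.≃ mkℚᵘ (+ a) d
toℚᵘ-/ a d = ℚ.toℚᵘ-fromℚᵘ (mkℚᵘ (+ a) d)

*≤*⇒/≤/ : ∀ a b d e → a * suc e ≤ b * suc d → + a / suc d ℚ.≤ + b / suc e
*≤*⇒/≤/ a b d e ae≤bd = ℚ.toℚᵘ-cancel-≤
  (ℚᵘ.≤-respˡ-≃ (ℚᵘ.≃-sym (toℚᵘ-/ a d)) (ℚᵘ.≤-respʳ-≃ (ℚᵘ.≃-sym (toℚᵘ-/ b e))
    (*≤* (subst₂ ℤ._≤_ (ℤ.pos-* a (suc e)) (ℤ.pos-* b (suc d)) (ℤ.+≤+ ae≤bd)))))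

fromℕ-mono-≤ : ∀ {a b} → a ≤ b → fromℕ a ℚ.≤ fromℕ b
fromℕ-mono-≤ {a} {b} a≤b = *≤*⇒/≤/ a b 0 0 (ℕ.*-monoˡ-≤ 1 a≤b)

0≤fromℕ : ∀ a → 0ℚ ℚ.≤ fromℕ a
0≤fromℕ a = fromℕ-mono-≤ {0} {a} z≤n

fromℕ-mono-< : ∀ {a b} → a ℕ.< b → fromℕ a < fromℕ b
fromℕ-mono-< {a} {b} a<b = ℚ.toℚᵘ-cancel-<
  (ℚᵘ.<-respˡ-≃ (ℚᵘ.≃-sym (toℚᵘ-/ a 0)) (ℚᵘ.<-respʳ-≃ (ℚᵘ.≃-sym (toℚᵘ-/ b 0))
    (*<* (subst₂ ℤ._<_ (ℤ.pos-* a 1) (ℤ.pos-* b 1) (ℤ.+<+ (ℕ.*-monoˡ-< 1 a<b))))))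

fromℕ-+ : ∀ a b → fromℕ (a + b) ≡ fromℕ a ℚ.+ fromℕ b
fromℕ-+ a b = ℚ.toℚᵘ-injective (begin
  ℚ.toℚᵘ (fromℕ (a + b))                  ≈⟨ toℚᵘ-/ (a + b) 0 ⟩
  mkℚᵘ (+ (a + b)) 0                      ≈⟨ *≡* (cong (ℤ._* + 1) numerators) ⟩
  mkℚᵘ (+ a) 0 ℚᵘ.+ mkℚᵘ (+ b) 0          ≈⟨ ℚᵘ.+-cong (ℚᵘ.≃-sym (toℚᵘ-/ a 0)) (ℚᵘ.≃-sym (toℚᵘ-/ b 0)) ⟩
  ℚ.toℚᵘ (fromℕ a) ℚᵘ.+ ℚ.toℚᵘ (fromℕ b)  ≈⟨ ℚᵘ.≃-sym (ℚ.toℚᵘ-homo-+ (fromℕ a) (fromℕ b)) ⟩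
  ℚ.toℚᵘ (fromℕ a ℚ.+ fromℕ b)            ∎)
  where
  open ℚᵘ.≃-Reasoning
  numerators : + (a + b) ≡ + a ℤ.* + 1 ℤ.+ + b ℤ.* + 1
  numerators = trans (ℤ.pos-+ a b) (sym (cong₂ ℤ._+_ (ℤ.*-identityʳ (+ a)) (ℤ.*-identityʳ (+ b))))

[_] : Bool → ℕ
[ b ] = if b then 1 else 0

sum-mono-≤ : ∀ {n} {f g : Fin n → ℕ} → (∀ i → f i ≤ g i) → sum f ≤ sum g
sum-mono-≤ {zero}  f≤g = z≤n
sum-mono-≤ {suc n} f≤g = ℕ.+-mono-≤ (f≤g zero) (sum-mono-≤ (f≤g ∘ suc))

sum-const : ∀ n c → sum {n} (λ _ → c) ≡ n * c
sum-const zero    c = refl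
sum-const (suc n) c = cong (λ s → c + s) (sum-const n c)

≤-sum : ∀ {n} (f : Fin n → ℕ) i → f i ≤ sum f
≤-sum f zero    = ℕ.m≤m+n (f zero) _
≤-sum f (suc i) = ℕ.≤-trans (≤-sum (f ∘ suc) i) (ℕ.m≤n+m _ (f zero))

sum-[≤ᵇtoℕ] : ∀ n t → ∑[ v < n ] [ t ≤ᵇ toℕ v ] ≡ n ∸ t
sum-[≤ᵇtoℕ] zero    t       = sym (ℕ.0∸n≡0 t)
sum-[≤ᵇtoℕ] (suc n) zero    = cong suc (sum-[≤ᵇtoℕ] n zero)
sum-[≤ᵇtoℕ] (suc n) (suc t) =
  trans (sum-cong-≗ {n} (λ v → cong [_] (suc≤ᵇsuc t (toℕ v)))) (sum-[≤ᵇtoℕ] n t)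
  where
  suc≤ᵇsuc : ∀ a b → (suc a ≤ᵇ suc b) ≡ (a ≤ᵇ b)
  suc≤ᵇsuc zero    b = refl
  suc≤ᵇsuc (suc a) b = refl

sum-if-≤ᵇtoℕ : ∀ n t c → ∑[ v < n ] (if t ≤ᵇ toℕ v then c else 0) ≡ c * (n ∸ t)
sum-if-≤ᵇtoℕ n t c = begin
  ∑[ v < n ] (if t ≤ᵇ toℕ v then c else 0)  ≡⟨ sum-cong-≗ {n} (λ v → if≡*[] (t ≤ᵇ toℕ v)) ⟩
  ∑[ v < n ] (c * [ t ≤ᵇ toℕ v ])           ≡⟨ *-distribˡ-sum {n} c _ ⟨
  c * ∑[ v < n ] [ t ≤ᵇ toℕ v ]             ≡⟨ cong (c *_) (sum-[≤ᵇtoℕ] n t) ⟩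
  c * (n ∸ t)                               ∎
  where
  open ≡-Reasoning
  if≡*[] : ∀ b → (if b then c else 0) ≡ c * [ b ]
  if≡*[] true  = sym (ℕ.*-identityʳ c)
  if≡*[] false = sym (ℕ.*-zeroʳ c)

sum-[]≤1 : ∀ {n} (p : Fin n → Bool) → (∀ i j → T (p i) → T (p j) → i ≡ j) → ∑[ i < n ] [ p i ] ≤ 1
sum-[]≤1 {zero}  p unique = z≤n
sum-[]≤1 {suc n} p unique with p zero in p0
... | true  = ℕ.+-monoʳ-≤ 1 (begin
  ∑[ i < n ] [ p (suc i) ]  ≤⟨ sum-mono-≤ rest≤0 ⟩
  ∑[ i < n ] 0              ≡⟨ sum-const n 0 ⟩
  n * 0                     ≡⟨ ℕ.*-zeroʳ n ⟩
  0                         ∎)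
  where
  open ℕ.≤-Reasoning
  rest≤0 : ∀ i → [ p (suc i) ] ≤ 0
  rest≤0 i with p (suc i) in pi
  ... | true  = ⊥-elim (Fin.0≢1+n (unique zero (suc i) (subst T (sym p0) _) (subst T (sym pi) _)))
  ... | false = z≤n
... | false = sum-[]≤1 (p ∘ suc) (λ i j pi pj → Fin.suc-injective (unique (suc i) (suc j) pi pj))

triangle : ℕ → ℕ
triangle n = ∑[ u < n ] (n ∸ suc (toℕ u))

triangle-identity : ∀ m → 2 * triangle m + m ≡ m * m
triangle-identity zero    = refl
triangle-identity (suc m) = begin
  2 * (m + triangle m) + suc m        ≡⟨ regroup m (triangle m) ⟩
  (2 * triangle m + m) + (2 * m + 1)  ≡⟨ cong (λ x → x + (2 * m + 1)) (triangle-identity m) ⟩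
  m * m + (2 * m + 1)                 ≡⟨ square-suc m ⟩
  suc m * suc m                       ∎
  where
  open ≡-Reasoning
  regroup : ∀ m t → 2 * (m + t) + suc m ≡ (2 * t + m) + (2 * m + 1)
  regroup = solve-∀
  square-suc : ∀ m → m * m + (2 * m + 1) ≡ suc m * suc m
  square-suc = solve-∀

triangle-large : ∀ {m} → 10 ≤′ m → 4 * m + 4 ℕ.< triangle m
triangle-large ≤′-refl                 = ℕ.≤-refl
triangle-large {suc m} (≤′-step 10≤m) = begin-strict
  4 * suc m + 4    ≡⟨ cong (_+ 4) (ℕ.*-suc 4 m) ⟩
  4 + (4 * m + 4)  <⟨ ℕ.+-mono-≤-< (ℕ.≤-trans (ℕ.m≤m+n 4 6) (ℕ.≤′⇒≤ 10≤m)) (triangle-large 10≤m) ⟩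
  m + triangle m   ∎
  where open ℕ.≤-Reasoning

countFin≡sum : ∀ {n} (p : Fin n → Bool) → countFin p ≡ ∑[ i < n ] [ p i ]
countFin≡sum {n} p = count-tabulate n (λ i → i)
  where
  count-tabulate : ∀ m (g : Fin m → Fin n) →
    foldr (λ x c → if p x then suc c else c) 0 (tabulate g) ≡ ∑[ i < m ] [ p (g i) ]
  count-tabulate zero    g = refl
  count-tabulate (suc m) g with p (g zero)
  ... | true  = cong suc (count-tabulate m (g ∘ suc))
  ... | false = count-tabulate m (g ∘ suc)

anyFin-intro : ∀ {n} (p : Fin n → Bool) i → T (p i) → T (anyFin p)
anyFin-intro {n} p = any-tabulate n (λ i → i)
  where
  any-tabulate : ∀ m (g : Fin m → Fin n) i → T (p (g i)) → T (foldr (λ x b → p x ∨ b) false (tabulate g))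
  any-tabulate (suc m) g zero    pgi with p (g zero)
  ... | true  = _
  any-tabulate (suc m) g (suc i) pgi with p (g zero)
  ... | true  = _
  ... | false = any-tabulate m (g ∘ suc) i pgi

anyFin-elim : ∀ {n} (p : Fin n → Bool) → T (anyFin p) → ∃ λ i → T (p i)
anyFin-elim {n} p = any-tabulate n (λ i → i)
  where
  any-tabulate : ∀ m (g : Fin m → Fin n) → T (foldr (λ x b → p x ∨ b) false (tabulate g)) → ∃ λ i → T (p i)
  any-tabulate (suc m) g any with p (g zero) in pg0
  ... | true  = g zero , subst T (sym pg0) _
  ... | false = any-tabulate m (g ∘ suc) any

sumℚ-allFin-≤ : ∀ {n} (f : Fin n → ℚ) (g : Fin n → ℕ) → (∀ i → f i ℚ.≤ fromℕ (g i)) →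
                sumℚ (map f (allFin n)) ℚ.≤ fromℕ (sum g)
sumℚ-allFin-≤ {n} f g f≤g = sum-tabulate n (λ i → i)
  where
  sum-tabulate : ∀ m (h : Fin m → Fin n) → sumℚ (map f (tabulate h)) ℚ.≤ fromℕ (∑[ i < m ] g (h i))
  sum-tabulate zero    h = ℚ.≤-refl
  sum-tabulate (suc m) h = ℚ.≤-trans (ℚ.+-mono-≤ (f≤g (h zero)) (sum-tabulate m (h ∘ suc)))
                                     (ℚ.≤-reflexive (sym (fromℕ-+ (g (h zero)) _)))

sumℚ-allFin-≥ : ∀ {n} (f : Fin n → ℚ) (g : Fin n → ℕ) → (∀ i → fromℕ (g i) ℚ.≤ f i) →
                fromℕ (sum g) ℚ.≤ sumℚ (map f (allFin n))
sumℚ-allFin-≥ {n} f g g≤f = sum-tabulate n (λ i → i)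
  where
  sum-tabulate : ∀ m (h : Fin m → Fin n) → fromℕ (∑[ i < m ] g (h i)) ℚ.≤ sumℚ (map f (tabulate h))
  sum-tabulate zero    h = ℚ.≤-refl
  sum-tabulate (suc m) h = ℚ.≤-trans (ℚ.≤-reflexive (fromℕ-+ (g (h zero)) _))
                                     (ℚ.+-mono-≤ (g≤f (h zero)) (sum-tabulate m (h ∘ suc)))

degree-pos : ∀ {n} (G : Graph n) v w → T (G v w) → 1 ≤ degree G v
degree-pos G v w vw = subst (1 ≤_) (sym (countFin≡sum (G v)))
  (ℕ.≤-trans (1≤[] vw) (≤-sum (λ x → [ G v x ]) w))
  where
  1≤[] : ∀ {b} → T b → 1 ≤ [ b ]
  1≤[] {true} _ = ℕ.≤-refl

-- Reachability and distance

reach-refl : ∀ {n} (G : Graph n) u → T (reach G 0 u u)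
reach-refl G u = ℕ.≡⇒≡ᵇ (toℕ u) (toℕ u) refl

reach-step : ∀ {n} (G : Graph n) k u w v → T (reach G k u w) → T (G w v) → T (reach G (suc k) u v)
reach-step G k u w v uw wv = Equivalence.from (Bool.T-∨ {reach G k u v})
  (inj₂ (anyFin-intro (λ x → reach G k u x ∧ G x v) w (Equivalence.from Bool.T-∧ (uw , wv))))

reach-0⇒≡ : ∀ {n} (G : Graph n) {u v} → T (reach G 0 u v) → u ≡ v
reach-0⇒≡ G {u} {v} uv = Fin.toℕ-injective (ℕ.≡ᵇ⇒≡ (toℕ u) (toℕ v) uv)

reach-1⇒adjacent : ∀ {n} (G : Graph n) {u v} → u ≢ v → T (reach G 1 u v) → T (G u v)
reach-1⇒adjacent G {u} {v} u≢v uv with Equivalence.to (Bool.T-∨ {reach G 0 u v}) uv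
... | inj₁ u=v = ⊥-elim (u≢v (reach-0⇒≡ G u=v))
... | inj₂ u~v =
  let w , uw∧wv = anyFin-elim (λ x → reach G 0 u x ∧ G x v) u~v
      uw , wv   = Equivalence.to (Bool.T-∧ {reach G 0 u w}) uw∧wv
  in subst (λ x → T (G x v)) (sym (reach-0⇒≡ G uw)) wv

searchDist-sound : ∀ {n} (G : Graph n) s f {u v d} → searchDist G s f u v ≡ just d → T (reach G d u v)
searchDist-sound G s zero {u} {v} eq with reach G s u v in uv
searchDist-sound G s zero    refl | true  = subst T (sym uv) _
searchDist-sound G s (suc f) {u} {v} eq with reach G s u v in uv
searchDist-sound G s (suc f) refl | true  = subst T (sym uv) _
...                               | false = searchDist-sound G (suc s) f eq

searchDist-complete : ∀ {n} (G : Graph n) s f {u v k} → T (reach G k u v) → s ≤ k → k ≤ s + f →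
                      ∃ λ d → searchDist G s f u v ≡ just d × d ≤ k
searchDist-complete G s zero {u} {v} uv s≤k k≤s+0 with reach G s u v in us
... | true  = s , refl , s≤k
... | false with ℕ.≤-antisym s≤k (subst (_ ≤_) (ℕ.+-identityʳ s) k≤s+0)
...   | refl = ⊥-elim (subst T us uv)
searchDist-complete G s (suc f) {u} {v} {k} uv s≤k k≤s+f with reach G s u v in us
... | true  = s , refl , s≤k
... | false = searchDist-complete G (suc s) f uv (ℕ.≤∧≢⇒< s≤k s≢k) (subst (k ≤_) (ℕ.+-suc s f) k≤s+f)
  where
  s≢k : s ≢ k
  s≢k refl = subst T us uv

dist-sound : ∀ {n} (G : Graph n) {u v d} → dist G u v ≡ just d → T (reach G d u v)
dist-sound {n} G = searchDist-sound G 0 n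

reach⇒dist≤ : ∀ {n} (G : Graph n) {u v k} → T (reach G k u v) → k ≤ n →
              ∃ λ d → dist G u v ≡ just d × d ≤ k
reach⇒dist≤ {n} G uv k≤n = searchDist-complete G 0 n uv z≤n k≤n

dist≡1⇒adjacent : ∀ {n} (G : Graph n) {u v} → dist G u v ≡ just 1 → T (G u v)
dist≡1⇒adjacent G {u} {v} d≡1 = reach-1⇒adjacent G u≢v (dist-sound G d≡1)
  where
  u≢v : u ≢ v
  u≢v refl with reach⇒dist≤ G (reach-refl G u) z≤n
  ... | _ , d≡0 , z≤n with trans (sym d≡1) d≡0
  ...   | ()

-- Bounds on H_A through bounds on its terms

pairTerm-≤ : ∀ {n} (G : Graph n) Δ → (∀ x → degree G x ≤ Δ) →
             ∀ u v → pairTerm G u v ℚ.≤ fromℕ (Δ + Δ * [ G u v ])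
pairTerm-≤ G Δ deg≤Δ u v with dist G u v in d≡
... | nothing            = 0≤fromℕ (Δ + Δ * [ G u v ])
... | just zero          = 0≤fromℕ (Δ + Δ * [ G u v ])
... | just (suc zero)    = fromℕ-mono-≤ (begin
  degree G u + degree G v  ≤⟨ ℕ.+-mono-≤ (deg≤Δ u) (deg≤Δ v) ⟩
  Δ + Δ                    ≡⟨ cong (λ x → Δ + x) (sym (ℕ.*-identityʳ Δ)) ⟩
  Δ + Δ * 1                ≡⟨ cong (λ b → Δ + Δ * [ b ]) (sym (Equivalence.to Bool.T-≡ u~v)) ⟩
  Δ + Δ * [ G u v ]        ∎)
  where
  open ℕ.≤-Reasoning
  u~v = dist≡1⇒adjacent G d≡
... | just (suc (suc d)) = *≤*⇒/≤/ (degree G u + degree G v) (Δ + Δ * [ G u v ]) (suc d) 0 (begin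
  (degree G u + degree G v) * 1  ≡⟨ ℕ.*-identityʳ _ ⟩
  degree G u + degree G v        ≤⟨ ℕ.+-mono-≤ (deg≤Δ u) (ℕ.≤-trans (deg≤Δ v) (ℕ.m≤m+n Δ 0)) ⟩
  2 * Δ                          ≤⟨ ℕ.*-monoˡ-≤ Δ (ℕ.m≤m+n 2 d) ⟩
  (2 + d) * Δ                    ≤⟨ ℕ.*-monoʳ-≤ (2 + d) (ℕ.m≤m+n Δ (Δ * [ G u v ])) ⟩
  (2 + d) * (Δ + Δ * [ G u v ])  ≡⟨ ℕ.*-comm (2 + d) (Δ + Δ * [ G u v ]) ⟩
  (Δ + Δ * [ G u v ]) * (2 + d)  ∎)
  where open ℕ.≤-Reasoning

pairTerm-≥ : ∀ {n} (G : Graph n) u v k a → u ≢ v → T (reach G (suc k) u v) → suc k ≤ n →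
             a * suc k ≤ degree G u + degree G v → fromℕ a ℚ.≤ pairTerm G u v
pairTerm-≥ G u v k a u≢v uv k<n a*k≤deg with reach⇒dist≤ G uv k<n
... | zero  , d≡0 , _   = ⊥-elim (u≢v (reach-0⇒≡ G (dist-sound G d≡0)))
... | suc d , d≡  , d≤k rewrite d≡ = *≤*⇒/≤/ a (degree G u + degree G v) 0 d (begin
  a * suc d                      ≤⟨ ℕ.*-monoʳ-≤ a d≤k ⟩
  a * suc k                      ≤⟨ a*k≤deg ⟩
  degree G u + degree G v        ≡⟨ ℕ.*-identityʳ _ ⟨
  (degree G u + degree G v) * 1  ∎)
  where open ℕ.≤-Reasoning

pairSum : (n : ℕ) → (Fin n → Fin n → ℕ) → ℕ
pairSum n w = ∑[ u < n ] ∑[ v < n ] (if suc (toℕ u) ≤ᵇ toℕ v then w u v else 0)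

HA-≤-pairSum : ∀ {n} (G : Graph n) (w : Fin n → Fin n → ℕ) →
               (∀ u v → toℕ u ℕ.< toℕ v → pairTerm G u v ℚ.≤ fromℕ (w u v)) →
               HA G ℚ.≤ fromℕ (pairSum n w)
HA-≤-pairSum G w bound = sumℚ-allFin-≤ _ _ (λ u → sumℚ-allFin-≤ _ _ (term-≤ u))
  where
  term-≤ : ∀ u v → (if suc (toℕ u) ≤ᵇ toℕ v then pairTerm G u v else 0ℚ)
                   ℚ.≤ fromℕ (if suc (toℕ u) ≤ᵇ toℕ v then w u v else 0)
  term-≤ u v with suc (toℕ u) ≤ᵇ toℕ v in u<ᵇv
  ... | true  = bound u v (ℕ.≤ᵇ⇒≤ _ _ (subst T (sym u<ᵇv) _))
  ... | false = ℚ.≤-refl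

pairSum-≤-HA : ∀ {n} (G : Graph n) (w : Fin n → Fin n → ℕ) →
               (∀ u v → toℕ u ℕ.< toℕ v → fromℕ (w u v) ℚ.≤ pairTerm G u v) →
               fromℕ (pairSum n w) ℚ.≤ HA G
pairSum-≤-HA G w bound = sumℚ-allFin-≥ _ _ (λ u → sumℚ-allFin-≥ _ _ (term-≥ u))
  where
  term-≥ : ∀ u v → fromℕ (if suc (toℕ u) ≤ᵇ toℕ v then w u v else 0)
                   ℚ.≤ (if suc (toℕ u) ≤ᵇ toℕ v then pairTerm G u v else 0ℚ)
  term-≥ u v with suc (toℕ u) ≤ᵇ toℕ v in u<ᵇv
  ... | true  = bound u v (ℕ.≤ᵇ⇒≤ _ _ (subst T (sym u<ᵇv) _))
  ... | false = ℚ.≤-refl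

pairSum-≤-maxDegree : ∀ {n} (G : Graph n) Δ → (∀ x → degree G x ≤ Δ) →
                      pairSum n (λ u v → Δ + Δ * [ G u v ]) ≤ Δ * triangle n + n * (Δ * Δ)
pairSum-≤-maxDegree {n} G Δ deg≤Δ = begin
  pairSum n (λ u v → Δ + Δ * [ G u v ])
    ≤⟨ sum-mono-≤ row-≤ ⟩
  ∑[ u < n ] (Δ * (n ∸ suc (toℕ u)) + Δ * Δ)
    ≡⟨ ∑-distrib-+ {n} (λ u → Δ * (n ∸ suc (toℕ u))) _ ⟩
  ∑[ u < n ] (Δ * (n ∸ suc (toℕ u))) + ∑[ u < n ] (Δ * Δ)
    ≡⟨ cong₂ _+_ (*-distribˡ-sum {n} Δ _) (sym (sum-const n (Δ * Δ))) ⟨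
  Δ * triangle n + n * (Δ * Δ)
    ∎
  where
  open ℕ.≤-Reasoning
  if-≤ : ∀ b x → (if b then Δ + x else 0) ≤ Δ * [ b ] + x
  if-≤ true  x = ℕ.≤-reflexive (cong (_+ x) (sym (ℕ.*-identityʳ Δ)))
  if-≤ false x = z≤n
  row-≤ : ∀ u → ∑[ v < n ] (if suc (toℕ u) ≤ᵇ toℕ v then Δ + Δ * [ G u v ] else 0)
                ≤ Δ * (n ∸ suc (toℕ u)) + Δ * Δ
  row-≤ u = begin
    ∑[ v < n ] (if suc (toℕ u) ≤ᵇ toℕ v then Δ + Δ * [ G u v ] else 0)
      ≤⟨ sum-mono-≤ (λ v → if-≤ (suc (toℕ u) ≤ᵇ toℕ v) (Δ * [ G u v ])) ⟩
    ∑[ v < n ] (Δ * [ suc (toℕ u) ≤ᵇ toℕ v ] + Δ * [ G u v ])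
      ≡⟨ ∑-distrib-+ {n} (λ v → Δ * [ suc (toℕ u) ≤ᵇ toℕ v ]) _ ⟩
    ∑[ v < n ] (Δ * [ suc (toℕ u) ≤ᵇ toℕ v ]) + ∑[ v < n ] (Δ * [ G u v ])
      ≡⟨ cong₂ _+_ (*-distribˡ-sum {n} Δ _) (*-distribˡ-sum {n} Δ _) ⟨
    Δ * ∑[ v < n ] [ suc (toℕ u) ≤ᵇ toℕ v ] + Δ * ∑[ v < n ] [ G u v ]
      ≡⟨ cong₂ (λ a b → Δ * a + Δ * b) (sum-[≤ᵇtoℕ] n (suc (toℕ u))) (sym (countFin≡sum (G u))) ⟩
    Δ * (n ∸ suc (toℕ u)) + Δ * degree G u
      ≤⟨ ℕ.+-monoʳ-≤ (Δ * (n ∸ suc (toℕ u))) (ℕ.*-monoʳ-≤ Δ (deg≤Δ u)) ⟩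
    Δ * (n ∸ suc (toℕ u)) + Δ * Δ
      ∎

HA-≤-maxDegree : ∀ {n} (G : Graph n) Δ → (∀ x → degree G x ≤ Δ) →
                 HA G ℚ.≤ fromℕ (Δ * triangle n + n * (Δ * Δ))
HA-≤-maxDegree G Δ deg≤Δ = ℚ.≤-trans (HA-≤-pairSum G _ (λ u v _ → pairTerm-≤ G Δ deg≤Δ u v))
                                     (fromℕ-mono-≤ (pairSum-≤-maxDegree G Δ deg≤Δ))

-- The cycle C_n

cycleSucc : ℕ → ℕ → ℕ → Bool
cycleSucc n a b = (suc a ≡ᵇ b) ∨ ((b ≡ᵇ 0) ∧ (suc a ≡ᵇ n))

cycleSucc⇒target≡ : ∀ n a b → b ℕ.< n → T (cycleSucc n a b) → b ≡ (if suc a ≡ᵇ n then 0 else suc a)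
cycleSucc⇒target≡ n a b b<n ab with suc a ≡ᵇ n in a+1≡ᵇn
... | true  with Equivalence.to (Bool.T-∨ {suc a ≡ᵇ b}) ab
...   | inj₁ a+1≡b = ⊥-elim (ℕ.<-irrefl b≡n b<n)
  where b≡n = trans (sym (ℕ.≡ᵇ⇒≡ (suc a) b a+1≡b)) (ℕ.≡ᵇ⇒≡ (suc a) n (subst T (sym a+1≡ᵇn) _))
...   | inj₂ b≡0   = ℕ.≡ᵇ⇒≡ b 0 (proj₁ (Equivalence.to (Bool.T-∧ {b ≡ᵇ 0}) b≡0))
cycleSucc⇒target≡ n a b b<n ab | false with Equivalence.to (Bool.T-∨ {suc a ≡ᵇ b}) ab
...   | inj₁ a+1≡b = sym (ℕ.≡ᵇ⇒≡ (suc a) b a+1≡b)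
...   | inj₂ b≡0∧⊥ = ⊥-elim (proj₂ (Equivalence.to (Bool.T-∧ {b ≡ᵇ 0}) b≡0∧⊥))

cycleSucc⇒source≡ : ∀ n a b → T (cycleSucc n a b) → a ≡ (if b ≡ᵇ 0 then n ∸ 1 else b ∸ 1)
cycleSucc⇒source≡ n a b ab with b ≡ᵇ 0 in b≡ᵇ0
... | true  with Equivalence.to (Bool.T-∨ {suc a ≡ᵇ b}) ab
...   | inj₁ a+1≡b = ⊥-elim (ℕ.1+n≢0 a+1≡0)
  where a+1≡0 = trans (ℕ.≡ᵇ⇒≡ (suc a) b a+1≡b) (ℕ.≡ᵇ⇒≡ b 0 (subst T (sym b≡ᵇ0) _))
...   | inj₂ a+1≡n = cong (_∸ 1) (ℕ.≡ᵇ⇒≡ (suc a) n a+1≡n)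
cycleSucc⇒source≡ n a b ab | false with Equivalence.to (Bool.T-∨ {suc a ≡ᵇ b}) ab
...   | inj₁ a+1≡b = cong (_∸ 1) (ℕ.≡ᵇ⇒≡ (suc a) b a+1≡b)
...   | inj₂ ()

[cycleGraph]≤[succ]+[pred] : ∀ n i j →
  [ cycleGraph n i j ] ≤ [ cycleSucc n (toℕ i) (toℕ j) ] + [ cycleSucc n (toℕ j) (toℕ i) ]
[cycleGraph]≤[succ]+[pred] n i j = [a∨b∨c∨d]≤[a∨d]+[b∨c]
  (suc (toℕ i) ≡ᵇ toℕ j) (suc (toℕ j) ≡ᵇ toℕ i)
  ((toℕ i ≡ᵇ 0) ∧ (suc (toℕ j) ≡ᵇ n)) ((toℕ j ≡ᵇ 0) ∧ (suc (toℕ i) ≡ᵇ n))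
  where
  [a∨b∨c∨d]≤[a∨d]+[b∨c] : ∀ a b c d → [ a ∨ (b ∨ (c ∨ d)) ] ≤ [ a ∨ d ] + [ b ∨ c ]
  [a∨b∨c∨d]≤[a∨d]+[b∨c] true  b     c     d     = s≤s z≤n
  [a∨b∨c∨d]≤[a∨d]+[b∨c] false true  c     d     = ℕ.m≤n+m 1 [ d ]
  [a∨b∨c∨d]≤[a∨d]+[b∨c] false false true  d     = ℕ.m≤n+m 1 [ d ]
  [a∨b∨c∨d]≤[a∨d]+[b∨c] false false false true  = s≤s z≤n
  [a∨b∨c∨d]≤[a∨d]+[b∨c] false false false false = z≤n

degree-cycleGraph-≤2 : ∀ n v → degree (cycleGraph n) v ≤ 2
degree-cycleGraph-≤2 n v = begin
  degree (cycleGraph n) v                        ≡⟨ countFin≡sum (cycleGraph n v) ⟩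
  ∑[ w < n ] [ cycleGraph n v w ]                ≤⟨ sum-mono-≤ {n} ([cycleGraph]≤[succ]+[pred] n v) ⟩
  ∑[ w < n ] ([ succ w ] + [ pred w ])           ≡⟨ ∑-distrib-+ {n} (λ w → [ succ w ]) _ ⟩
  ∑[ w < n ] [ succ w ] + ∑[ w < n ] [ pred w ]  ≤⟨ ℕ.+-mono-≤ (sum-[]≤1 succ succ-unique)
                                                                (sum-[]≤1 pred pred-unique) ⟩
  1 + 1                                          ∎
  where
  open ℕ.≤-Reasoning
  succ pred : Fin n → Bool
  succ w = cycleSucc n (toℕ v) (toℕ w)
  pred w = cycleSucc n (toℕ w) (toℕ v)
  succ-unique : ∀ w w′ → T (succ w) → T (succ w′) → w ≡ w′
  succ-unique w w′ vw vw′ = Fin.toℕ-injective (trans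
    (cycleSucc⇒target≡ n (toℕ v) (toℕ w) (Fin.toℕ<n w) vw)
    (sym (cycleSucc⇒target≡ n (toℕ v) (toℕ w′) (Fin.toℕ<n w′) vw′)))
  pred-unique : ∀ w w′ → T (pred w) → T (pred w′) → w ≡ w′
  pred-unique w w′ wv w′v = Fin.toℕ-injective (trans
    (cycleSucc⇒source≡ n (toℕ w) (toℕ v) wv)
    (sym (cycleSucc⇒source≡ n (toℕ w′) (toℕ v) w′v)))

HA-cycleGraph-≤ : ∀ n → HA (cycleGraph n) ℚ.≤ fromℕ (2 * triangle n + n * 4)
HA-cycleGraph-≤ n = HA-≤-maxDegree (cycleGraph n) 2 (degree-cycleGraph-≤2 n)

-- The graph CS_{3,n-3}

degree-csGraph-centre : ∀ m → degree (csGraph (suc m)) zero ≡ m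
degree-csGraph-centre m = trans (countFin≡sum (csGraph (suc m) zero))
                                (trans (sum-const m 1) (ℕ.*-identityʳ m))

csWeight : ∀ {m} → Fin (suc m) → ℕ
csWeight {m} zero = suc m
csWeight (suc _)  = 1

csWeight-≤-pairTerm : ∀ m u v → toℕ u ℕ.< toℕ v → fromℕ (csWeight u) ℚ.≤ pairTerm (csGraph (suc m)) u v
csWeight-≤-pairTerm m zero (suc v) _ =
  pairTerm-≥ G zero (suc v) 0 (suc m) (λ ()) (reach-step G 0 zero zero (suc v) (reach-refl G zero) _) (s≤s z≤n)
    (begin
      suc m * 1                         ≡⟨ ℕ.*-identityʳ (suc m) ⟩
      suc m                             ≡⟨ ℕ.+-comm 1 m ⟩
      m + 1                             ≤⟨ ℕ.+-mono-≤ (ℕ.≤-reflexive (sym (degree-csGraph-centre m)))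
                                                      (degree-pos G (suc v) zero _) ⟩
      degree G zero + degree G (suc v)  ∎)
  where
  G = csGraph (suc m)
  open ℕ.≤-Reasoning
csWeight-≤-pairTerm m (suc u) (suc v) u<v =
  pairTerm-≥ G (suc u) (suc v) 1 1 u≢v u~0~v 2≤n
    (ℕ.+-mono-≤ (degree-pos G (suc u) zero _) (degree-pos G (suc v) zero _))
  where
  G = csGraph (suc m)
  u≢v : suc u ≢ suc v
  u≢v u≡v = ℕ.<-irrefl (cong toℕ u≡v) u<v
  u~0~v : T (reach G 2 (suc u) (suc v))
  u~0~v = reach-step G 1 (suc u) zero (suc v) (reach-step G 0 (suc u) (suc u) zero (reach-refl G (suc u)) _) _
  2≤n : 2 ≤ suc m
  2≤n = ℕ.≤-trans (ℕ.≤-trans (s≤s (s≤s z≤n)) u<v) (ℕ.<⇒≤ (Fin.toℕ<n (suc v)))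

pairSum-csWeight : ∀ m → pairSum (suc m) (λ u _ → csWeight u) ≡ suc m * m + triangle m
pairSum-csWeight m = begin
  pairSum (suc m) (λ u _ → csWeight u)
    ≡⟨ sum-cong-≗ {suc m} (λ u → sum-if-≤ᵇtoℕ (suc m) (suc (toℕ u)) (csWeight u)) ⟩
  suc m * m + ∑[ u < m ] (1 * (m ∸ suc (toℕ u)))
    ≡⟨ cong (λ x → suc m * m + x) (sum-cong-≗ {m} (λ u → ℕ.*-identityˡ (m ∸ suc (toℕ u)))) ⟩
  suc m * m + triangle m
    ∎
  where open ≡-Reasoning

HA-csGraph-≥ : ∀ m → fromℕ (suc m * m + triangle m) ℚ.≤ HA (csGraph (suc m))
HA-csGraph-≥ m = subst (λ s → fromℕ s ℚ.≤ HA (csGraph (suc m))) (pairSum-csWeight m)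
                       (pairSum-≤-HA (csGraph (suc m)) (λ u _ → csWeight u) (csWeight-≤-pairTerm m))

cycle-bound<cs-bound : ∀ {m} → 10 ≤′ m → 2 * triangle (suc m) + suc m * 4 ℕ.< suc m * m + triangle m
cycle-bound<cs-bound {m} 10≤m = begin-strict
  2 * (m + triangle m) + suc m * 4        ≡⟨ regroup m (triangle m) ⟩
  m + (2 * triangle m + m) + (4 * m + 4)  <⟨ ℕ.+-monoʳ-< (m + (2 * triangle m + m)) (triangle-large 10≤m) ⟩
  m + (2 * triangle m + m) + triangle m   ≡⟨ cong (λ x → m + x + triangle m) (triangle-identity m) ⟩
  suc m * m + triangle m                  ∎
  where
  open ℕ.≤-Reasoning
  regroup : ∀ m t → 2 * (m + t) + suc m * 4 ≡ m + (2 * t + m) + (4 * m + 4)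
  regroup = solve-∀

HA-cycleGraph<HA-csGraph : ∀ {m} → 10 ≤′ m → HA (cycleGraph (suc m)) < HA (csGraph (suc m))
HA-cycleGraph<HA-csGraph {m} 10≤m =
  ℚ.≤-<-trans (HA-cycleGraph-≤ (suc m))
    (ℚ.<-≤-trans (fromℕ-mono-< (cycle-bound<cs-bound 10≤m)) (HA-csGraph-≥ m))

mainTheorem4 : (n k : ℕ) → n ≡ 2 * k + 1 → 5 ≤ n → HA (cycleGraph n) < HA (csGraph n)
mainTheorem4 _ 0 refl (s≤s ())
mainTheorem4 _ 1 refl (s≤s (s≤s (s≤s ())))
mainTheorem4 _ 2 refl _ = toWitness {a? = HA (cycleGraph 5) ℚ.<? HA (csGraph 5)} _
mainTheorem4 _ 3 refl _ = toWitness {a? = HA (cycleGraph 7) ℚ.<? HA (csGraph 7)} _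
mainTheorem4 _ 4 refl _ = toWitness {a? = HA (cycleGraph 9) ℚ.<? HA (csGraph 9)} _
mainTheorem4 _ k@(suc (suc (suc (suc (suc k′))))) refl _ =
  subst (λ n → HA (cycleGraph n) < HA (csGraph n)) (ℕ.+-comm 1 (2 * k))
    (HA-cycleGraph<HA-csGraph {2 * k} (ℕ.≤⇒≤′ (ℕ.*-monoʳ-≤ 2 (ℕ.m≤m+n 5 k′))))
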